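{- Let $C=\langle a,b\rangle$ be an HFP-code of type Q of length $4n$, and let $h$ be a positive divisor of $n$. Then $\pi_a^h(a^n)\neq a^n$, where $a^n$ is the $n$-th power of $a$ in the group $(C,\cdot)$.
   Context: Let $\mathbb{F}=\mathbb{Z}_2$. $\mathbf 0,\mathbf 1$ denote the all-zero and all-one vectors; for a permutation $\pi$ of $\{1,\dots,m\}$ and $v\in\mathbb{F}^m$, $\pi(v)=(v_{\pi^{ -1}(1)},\dots,v_{\pi^{ -1}(m)})$. A binary Hadamard matrix of order $4n$ is obtained from a $4n\times4n$ matrix with entries $\pm1$ and $HH^T=4nI$ by replacing $+1$ by $0$ and $-1$ by $1$; the binary Hadamard code it defines is the set of its rows together with their complements. A code $C\subseteq\mathbb{F}^m$ with $\mathbf 0\in C$ is propelinear if to each $x\in C$ a coordinate permutation $\pi_x$ is assigned such that for all $x,y\in C$: $x+\pi_x(y)\in C$ and $\pi_x\pi_y=\pi_{x+\pi_x(y)}$; then $x\cdot y:=x+\pi_x(y)$ makes $(C,\cdot)$ a group with identity $\mathbf 0$. An HFP-code of length $4n$ is a propelinear code that is also a binary Hadamard code of length $4n$, with $\pi_{\mathbf 0}=\pi_{\mathbf 1}=\mathrm{id}$ and such that for every $a\in C\setminus\{\mathbf 0,\mathbf 1\}$, $\pi_a$ has no fixed coordinate. An HFP-code $C$ of length $4n$ is of type Q, written $C=\langle a,b\rangle$, if there are $a,b\in C$ generating $(C,\cdot)$ with presentation $\langle a,b: a^{4n}=\mathbf 0,\ a^{2n}=b^2,\ b^{ -1}ab=a^{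 -1}\rangle$. -}

module Defs where

open import Data.Nat using (ℕ; zero; suc; _*_)
open import Data.Bool using (Bool; true; false; _xor_; not)
open import Data.Integer as ℤ using (ℤ; +_; -[1+_])
open import Data.Fin using (Fin; zero; suc)
open import Data.Fin.Permutation using (Permutation′; _⟨$⟩ʳ_; _⟨$⟩ˡ_)
open import Data.Vec using (Vec; tabulate; lookup; zipWith; replicate; map)
open import Data.Product using (Σ; ∃; _×_; _,_)
open import Data.Sum using (_⊎_)
open import Relation.Binary.PropositionalEquality using (_≡_; _≢_)

-- Binary words of length m (vectors over F = Z_2, with true = 1).
Word : ℕ → Set
Word m = Vec Bool m

𝟎 : ∀ {m} → Word m
𝟎 = replicate _ false

𝟏 : ∀ {m} → Word m
𝟏 = replicate _ true

_⊕_ : ∀ {m} → Word m → Word m → Word m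
_⊕_ = zipWith _xor_

act : ∀ {m} → Permutation′ m → Word m → Word m
act π v = tabulate (λ i → lookup v (π ⟨$⟩ˡ i))

Σℤ : ∀ {m} → (Fin m → ℤ) → ℤ
Σℤ {zero} f = + 0
Σℤ {suc m} f = f zero ℤ.+ Σℤ (λ i → f (suc i))

record IsHadamard (m : ℕ) (H : Fin m → Fin m → ℤ) : Set where
  field
    entries : ∀ i j → H i j ≡ + 1 ⊎ H i j ≡ -[1+ 0 ]
    diag    : ∀ i → Σℤ (λ k → H i k ℤ.* H i k) ≡ + m
    offdiag : ∀ i j → i ≢ j → Σℤ (λ k → H i k ℤ.* H j k) ≡ + 0

toBit : ℤ → Bool
toBit (+ _) = false
toBit -[1+ _ ] = true

binRow : ∀ {m} → (Fin m → Fin m → ℤ) → Fin m → Word m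
binRow H i = tabulate (λ k → toBit (H i k))

Code : ℕ → Set₁
Code m = Word m → Set

IsHadamardCode : ∀ m → Code m → Set
IsHadamardCode m C =
  Σ (Fin m → Fin m → ℤ) λ H → IsHadamard m H ×
    (∀ x → (C x → ∃ λ i → x ≡ binRow H i ⊎ x ≡ map not (binRow H i)) ×
           ((∃ λ i → x ≡ binRow H i ⊎ x ≡ map not (binRow H i)) → C x))

-- Assignment of coordinate permutations x ↦ π_x (only values on C matter)
Assignment : ℕ → Set
Assignment m = Word m → Permutation′ m

mul : ∀ {m} → Assignment m → Word m → Word m → Word m
mul π x y = x ⊕ act (π x) y

record IsPropelinear (m : ℕ) (C : Code m) (π : Assignment m) : Set where
  field
    zero∈ : C 𝟎
    closed : ∀ x y → C x → C y → C (mul π x y)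
    compat : ∀ x y → C x → C y →
             ∀ i → π x ⟨$⟩ʳ (π y ⟨$⟩ʳ i) ≡ π (mul π x y) ⟨$⟩ʳ i

record IsHFP (m : ℕ) (C : Code m) (π : Assignment m) : Set where
  field
    propelinear : IsPropelinear m C π
    hadamard    : IsHadamardCode m C
    π𝟎-id : ∀ i → π 𝟎 ⟨$⟩ʳ i ≡ i
    π𝟏-id : ∀ i → π 𝟏 ⟨$⟩ʳ i ≡ i
    fixfree : ∀ a → C a → a ≢ 𝟎 → a ≢ 𝟏 → ∀ i → π a ⟨$⟩ʳ i ≢ i

pow : ∀ {m} → Assignment m → Word m → ℕ → Word m
pow π x zero = 𝟎
pow π x (suc k) = mul π x (pow π x k)

actIter : ∀ {m} → Permutation′ m → ℕ → Word m → Word m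
actIter π zero v = v
actIter π (suc k) v = act π (actIter π k v)

data Gen {m} (C : Code m) (π : Assignment m) (a b : Word m) : Word m → Set where
  g𝟎   : Gen C π a b 𝟎
  ga   : Gen C π a b a
  gb   : Gen C π a b b
  gmul : ∀ {x y} → Gen C π a b x → Gen C π a b y → Gen C π a b (mul π x y)
  ginv : ∀ {x y} → C y → Gen C π a b x → mul π y x ≡ 𝟎 → Gen C π a b y

record IsTypeQ (n : ℕ) (C : Code (4 * n)) (π : Assignment (4 * n))
               (a b : Word (4 * n)) : Set where
  field
    hfp  : IsHFP (4 * n) C π
    a∈   : C a
    b∈   : C b
    generates : ∀ x → C x → Gen C π a b x
    rel1 : pow π a (4 * n) ≡ 𝟎
    rel2 : pow π a (2 * n) ≡ mul π b b
    rel3 : ∃ λ b⁻¹ → ∃ λ a⁻¹ → C b⁻¹ × C a⁻¹ ×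
             mul π b⁻¹ b ≡ 𝟎 × mul π a⁻¹ a ≡ 𝟎 ×
             mul π (mul π b⁻¹ a) b ≡ a⁻¹

-- If π_a^h fixes a^n then so does π_a^n = π_{a^n}, hence a^{2n} = a^n ⊕ π_{a^n}(a^n) = 0.
-- Then b² = a^{2n} = 0 and b a = a⁻¹ b = a^{2n-1} b, so every element of the group
-- generated by a and b is a^i or a^i b with i < 2n, and the code has at most 4n words.
-- But the 4n rows of a Hadamard matrix and their complements are pairwise distinct:
-- two equal words would give two rows with inner product 4n or -4n, whereas the
-- inner product of two rows is 0 or 4n.
module Submission where

open import Defs
open import Data.Nat using (ℕ; _*_; NonZero)
open import Data.Nat.Divisibility using (_∣_)
open import Relation.Binary.PropositionalEquality using (_≢_)

open import Data.Nat using (zero; suc; _+_; _≤_; _<_; _/_; _%_; pred; z≤n; s≤s)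
open import Data.Nat.Properties using (+-identityʳ; *-suc; *-distribʳ-+; m<m+n; <⇒≱)
open import Data.Nat.DivMod using (_mod_; m≡m%n+[m/n]*n; m%n<n)
open import Data.Nat.Divisibility using (divides)
open import Data.Bool using (false; _xor_; not)
open import Data.Bool.Properties using (xor-assoc; xor-same; xor-identityˡ; xor-identityʳ; not-injective)
open import Data.Integer as ℤ using (ℤ; +_; -[1+_])
open import Data.Fin as Fin using (Fin; toℕ; splitAt; join)
open import Data.Fin.Properties using (_≟_; toℕ-fromℕ<; injective⇒≤; splitAt-join; join-splitAt)
open import Data.Fin.Permutation using (Permutation′; _⟨$⟩ʳ_; _⟨$⟩ˡ_; inverseˡ; inverseʳ)
open import Data.Vec using ([]; _∷_; tabulate; lookup; map)
open import Data.Vec.Properties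
  using (tabulate∘lookup; tabulate-cong; lookup∘tabulate; lookup-zipWith; lookup-replicate; lookup-map;
         zipWith-assoc; zipWith-identityˡ; zipWith-identityʳ)
open import Data.Product using (∃; _,_; proj₁; proj₂)
open import Data.Sum as Sum using (_⊎_; inj₁; inj₂)
open import Data.Empty using (⊥-elim)
open import Function using (_∘_)
open import Function.Definitions using (Injective)
open import Relation.Nullary using (¬_; yes; no)
open import Relation.Binary.PropositionalEquality
  using (_≡_; refl; sym; trans; cong; cong₂; subst; module ≡-Reasoning)

open ≡-Reasoning

word-ext : ∀ {m} {u v : Word m} → (∀ i → lookup u i ≡ lookup v i) → u ≡ v
word-ext {u = u} {v} u≗v = begin
  u                    ≡⟨ tabulate∘lookup u ⟨
  tabulate (lookup u)  ≡⟨ tabulate-cong u≗v ⟩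
  tabulate (lookup v)  ≡⟨ tabulate∘lookup v ⟩
  v                    ∎

⊕-assoc : ∀ {m} (u v w : Word m) → (u ⊕ v) ⊕ w ≡ u ⊕ (v ⊕ w)
⊕-assoc = zipWith-assoc xor-assoc

⊕-identityˡ : ∀ {m} (u : Word m) → 𝟎 ⊕ u ≡ u
⊕-identityˡ = zipWith-identityˡ xor-identityˡ

⊕-identityʳ : ∀ {m} (u : Word m) → u ⊕ 𝟎 ≡ u
⊕-identityʳ = zipWith-identityʳ xor-identityʳ

⊕-self : ∀ {m} (u : Word m) → u ⊕ u ≡ 𝟎
⊕-self []      = refl
⊕-self (x ∷ u) = cong₂ _∷_ (xor-same x) (⊕-self u)

lookup-act : ∀ {m} (σ : Permutation′ m) v i → lookup (act σ v) i ≡ lookup v (σ ⟨$⟩ˡ i)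
lookup-act σ v = lookup∘tabulate _

act-𝟎 : ∀ {m} (σ : Permutation′ m) → act σ 𝟎 ≡ 𝟎
act-𝟎 σ = word-ext λ i → trans (lookup-act σ 𝟎 i)
  (trans (lookup-replicate (σ ⟨$⟩ˡ i) false) (sym (lookup-replicate i false)))

act-⊕ : ∀ {m} (σ : Permutation′ m) u v → act σ (u ⊕ v) ≡ act σ u ⊕ act σ v
act-⊕ σ u v = word-ext λ i → begin
  lookup (act σ (u ⊕ v)) i                        ≡⟨ lookup-act σ (u ⊕ v) i ⟩
  lookup (u ⊕ v) (σ ⟨$⟩ˡ i)                       ≡⟨ lookup-zipWith _xor_ (σ ⟨$⟩ˡ i) u v ⟩
  lookup u (σ ⟨$⟩ˡ i) xor lookup v (σ ⟨$⟩ˡ i)     ≡⟨ cong₂ _xor_ (lookup-act σ u i) (lookup-act σ v i) ⟨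
  lookup (act σ u) i xor lookup (act σ v) i       ≡⟨ lookup-zipWith _xor_ i (act σ u) (act σ v) ⟨
  lookup (act σ u ⊕ act σ v) i                    ∎

act-id : ∀ {m} (σ : Permutation′ m) → (∀ i → σ ⟨$⟩ʳ i ≡ i) → ∀ v → act σ v ≡ v
act-id σ σ≗id v = word-ext λ i → trans (lookup-act σ v i)
  (cong (lookup v) (trans (cong (σ ⟨$⟩ˡ_) (sym (σ≗id i))) (inverseˡ σ)))

act-∘ : ∀ {m} (σ τ ρ : Permutation′ m) → (∀ i → σ ⟨$⟩ʳ i ≡ τ ⟨$⟩ʳ (ρ ⟨$⟩ʳ i)) →
        ∀ v → act σ v ≡ act τ (act ρ v)
act-∘ σ τ ρ σ≗τρ v = word-ext λ i → begin
  lookup (act σ v) i                ≡⟨ lookup-act σ v i ⟩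
  lookup v (σ ⟨$⟩ˡ i)               ≡⟨ cong (lookup v) (σˡ≗ρˡτˡ i) ⟩
  lookup v (ρ ⟨$⟩ˡ (τ ⟨$⟩ˡ i))      ≡⟨ lookup-act ρ v (τ ⟨$⟩ˡ i) ⟨
  lookup (act ρ v) (τ ⟨$⟩ˡ i)       ≡⟨ lookup-act τ (act ρ v) i ⟨
  lookup (act τ (act ρ v)) i        ∎
  where
  σˡ≗ρˡτˡ : ∀ i → σ ⟨$⟩ˡ i ≡ ρ ⟨$⟩ˡ (τ ⟨$⟩ˡ i)
  σˡ≗ρˡτˡ i = begin
    σ ⟨$⟩ˡ i                                    ≡⟨ cong (σ ⟨$⟩ˡ_) (inverseʳ τ) ⟨
    σ ⟨$⟩ˡ (τ ⟨$⟩ʳ (τ ⟨$⟩ˡ i))                  ≡⟨ cong (λ j → σ ⟨$⟩ˡ (τ ⟨$⟩ʳ j)) (inverseʳ ρ) ⟨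
    σ ⟨$⟩ˡ (τ ⟨$⟩ʳ (ρ ⟨$⟩ʳ (ρ ⟨$⟩ˡ (τ ⟨$⟩ˡ i))))  ≡⟨ cong (σ ⟨$⟩ˡ_) (σ≗τρ _) ⟨
    σ ⟨$⟩ˡ (σ ⟨$⟩ʳ (ρ ⟨$⟩ˡ (τ ⟨$⟩ˡ i)))          ≡⟨ inverseˡ σ ⟩
    ρ ⟨$⟩ˡ (τ ⟨$⟩ˡ i)                           ∎

actIter-+ : ∀ {m} (σ : Permutation′ m) i j v → actIter σ (i + j) v ≡ actIter σ i (actIter σ j v)
actIter-+ σ zero    j v = refl
actIter-+ σ (suc i) j v = cong (act σ) (actIter-+ σ i j v)

actIter-* : ∀ {m} (σ : Permutation′ m) {h v} → actIter σ h v ≡ v → ∀ q → actIter σ (q * h) v ≡ v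
actIter-* σ         σʰv≡v zero    = refl
actIter-* σ {h} {v} σʰv≡v (suc q) = begin
  actIter σ (h + q * h) v          ≡⟨ actIter-+ σ h (q * h) v ⟩
  actIter σ h (actIter σ (q * h) v) ≡⟨ cong (actIter σ h) (actIter-* σ σʰv≡v q) ⟩
  actIter σ h v                     ≡⟨ σʰv≡v ⟩
  v                                 ∎

module PropelinearGroup {m} {C : Code m} {π : Assignment m}
                        (P : IsPropelinear m C π) (π𝟎≗id : ∀ i → π 𝟎 ⟨$⟩ʳ i ≡ i) where
  open IsPropelinear P

  infixl 25 _·_
  infixr 30 _^_

  _·_ : Word m → Word m → Word m
  _·_ = mul π

  _^_ : Word m → ℕ → Word m
  _^_ = pow π

  act-· : ∀ {x y} → C x → C y → ∀ v → act (π (x · y)) v ≡ act (π x) (act (π y) v)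
  act-· {x} {y} x∈ y∈ = act-∘ (π (x · y)) (π x) (π y) λ i → sym (compat x y x∈ y∈ i)

  ·-assoc : ∀ {x y z} → C x → C y → C z → (x · y) · z ≡ x · (y · z)
  ·-assoc {x} {y} {z} x∈ y∈ z∈ = begin
    (x ⊕ act (π x) y) ⊕ act (π (x · y)) z        ≡⟨ cong ((x ⊕ act (π x) y) ⊕_) (act-· x∈ y∈ z) ⟩
    (x ⊕ act (π x) y) ⊕ act (π x) (act (π y) z)  ≡⟨ ⊕-assoc x _ _ ⟩
    x ⊕ (act (π x) y ⊕ act (π x) (act (π y) z))  ≡⟨ cong (x ⊕_) (act-⊕ (π x) y _) ⟨
    x · (y · z)                                  ∎

  ·-identityˡ : ∀ x → 𝟎 · x ≡ x
  ·-identityˡ x = trans (⊕-identityˡ _) (act-id (π 𝟎) π𝟎≗id x)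

  ·-identityʳ : ∀ x → x · 𝟎 ≡ x
  ·-identityʳ x = trans (cong (x ⊕_) (act-𝟎 (π x))) (⊕-identityʳ x)

  inverse-unique : ∀ {y x z} → C y → C x → C z → y · x ≡ 𝟎 → x · z ≡ 𝟎 → y ≡ z
  inverse-unique {y} {x} {z} y∈ x∈ z∈ yx≡𝟎 xz≡𝟎 = begin
    y            ≡⟨ ·-identityʳ y ⟨
    y · 𝟎        ≡⟨ cong (y ·_) xz≡𝟎 ⟨
    y · (x · z)  ≡⟨ ·-assoc y∈ x∈ z∈ ⟨
    (y · x) · z  ≡⟨ cong (_· z) yx≡𝟎 ⟩
    𝟎 · z        ≡⟨ ·-identityˡ z ⟩
    z            ∎

  involution-conjugate : ∀ {a b b⁻¹ a⁻¹ c} → C a → C b → C b⁻¹ → C a⁻¹ → C c →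
                         b · b ≡ 𝟎 → a · c ≡ 𝟎 → b⁻¹ · b ≡ 𝟎 → a⁻¹ · a ≡ 𝟎 →
                         (b⁻¹ · a) · b ≡ a⁻¹ → b · a ≡ c · b
  involution-conjugate {a} {b} {b⁻¹} {a⁻¹} {c}
                       a∈ b∈ b⁻¹∈ a⁻¹∈ c∈ bb≡𝟎 ac≡𝟎 b⁻¹b≡𝟎 a⁻¹a≡𝟎 b⁻¹ab≡a⁻¹ = begin
    b · a                ≡⟨ ·-identityʳ (b · a) ⟨
    (b · a) · 𝟎          ≡⟨ cong (b · a ·_) bb≡𝟎 ⟨
    (b · a) · (b · b)    ≡⟨ ·-assoc (closed b a b∈ a∈) b∈ b∈ ⟨
    (b · a) · b · b      ≡⟨ cong (λ w → (w · a) · b · b) b⁻¹≡b ⟨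
    (b⁻¹ · a) · b · b    ≡⟨ cong (_· b) (trans b⁻¹ab≡a⁻¹ a⁻¹≡c) ⟩
    c · b                ∎
    where
    b⁻¹≡b : b⁻¹ ≡ b
    b⁻¹≡b = inverse-unique b⁻¹∈ b∈ b∈ b⁻¹b≡𝟎 bb≡𝟎
    a⁻¹≡c : a⁻¹ ≡ c
    a⁻¹≡c = inverse-unique a⁻¹∈ a∈ c∈ a⁻¹a≡𝟎 ac≡𝟎

  module Powers {x} (x∈ : C x) where

    ^-∈ : ∀ k → C (x ^ k)
    ^-∈ zero    = zero∈
    ^-∈ (suc k) = closed x (x ^ k) x∈ (^-∈ k)

    ^-+ : ∀ i j → x ^ (i + j) ≡ x ^ i · x ^ j
    ^-+ zero    j = sym (·-identityˡ (x ^ j))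
    ^-+ (suc i) j = trans (cong (x ·_) (^-+ i j)) (sym (·-assoc x∈ (^-∈ i) (^-∈ j)))

    act-^ : ∀ k v → act (π (x ^ k)) v ≡ actIter (π x) k v
    act-^ zero    v = act-id (π 𝟎) π𝟎≗id v
    act-^ (suc k) v = trans (act-· x∈ (^-∈ k) v) (cong (act (π x)) (act-^ k v))

    ^-*≡𝟎 : ∀ {N} → x ^ N ≡ 𝟎 → ∀ q → x ^ (q * N) ≡ 𝟎
    ^-*≡𝟎     xᴺ≡𝟎 zero    = refl
    ^-*≡𝟎 {N} xᴺ≡𝟎 (suc q) = begin
      x ^ (N + q * N)      ≡⟨ ^-+ N (q * N) ⟩
      x ^ N · x ^ (q * N)  ≡⟨ cong₂ _·_ xᴺ≡𝟎 (^-*≡𝟎 xᴺ≡𝟎 q) ⟩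
      𝟎 · 𝟎                ≡⟨ ·-identityˡ 𝟎 ⟩
      𝟎                    ∎

    ^-% : ∀ {N} .{{_ : NonZero N}} → x ^ N ≡ 𝟎 → ∀ i → x ^ i ≡ x ^ (i % N)
    ^-% {N} xᴺ≡𝟎 i = begin
      x ^ i                          ≡⟨ cong (x ^_) (m≡m%n+[m/n]*n i N) ⟩
      x ^ (i % N + i / N * N)        ≡⟨ ^-+ (i % N) (i / N * N) ⟩
      x ^ (i % N) · x ^ (i / N * N)  ≡⟨ cong (x ^ (i % N) ·_) (^-*≡𝟎 xᴺ≡𝟎 (i / N)) ⟩
      x ^ (i % N) · 𝟎                ≡⟨ ·-identityʳ (x ^ (i % N)) ⟩
      x ^ (i % N)                    ∎

    ^-double≡𝟎 : ∀ k → actIter (π x) k (x ^ k) ≡ x ^ k → x ^ (2 * k) ≡ 𝟎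
    ^-double≡𝟎 k fixed = begin
      x ^ (k + (k + 0))                ≡⟨ cong (λ j → x ^ (k + j)) (+-identityʳ k) ⟩
      x ^ (k + k)                      ≡⟨ ^-+ k k ⟩
      x ^ k ⊕ act (π (x ^ k)) (x ^ k)  ≡⟨ cong (x ^ k ⊕_) (trans (act-^ k (x ^ k)) fixed) ⟩
      x ^ k ⊕ x ^ k                    ≡⟨ ⊕-self (x ^ k) ⟩
      𝟎                                ∎

  open Powers public

  module Dihedral {a b} (a∈ : C a) (b∈ : C b) (M : ℕ) (aᴺ≡𝟎 : a ^ suc M ≡ 𝟎)
                  (b²≡𝟎 : b · b ≡ 𝟎) (ba≡aᴹb : b · a ≡ a ^ M · b) where

    N : ℕ
    N = suc M

    dihedral : ℕ ⊎ ℕ → Word m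
    dihedral (inj₁ i) = a ^ i
    dihedral (inj₂ i) = a ^ i · b

    _⋆_ : ℕ ⊎ ℕ → ℕ ⊎ ℕ → ℕ ⊎ ℕ
    inj₁ i ⋆ inj₁ j = inj₁ (i + j)
    inj₁ i ⋆ inj₂ j = inj₂ (i + j)
    inj₂ i ⋆ inj₁ j = inj₂ (i + j * M)
    inj₂ i ⋆ inj₂ j = inj₁ (i + j * M)

    inverse : ℕ ⊎ ℕ → ℕ ⊎ ℕ
    inverse (inj₁ i) = inj₁ (i * M)
    inverse (inj₂ i) = inj₂ i

    dihedral-∈ : ∀ s → C (dihedral s)
    dihedral-∈ (inj₁ i) = ^-∈ a∈ i
    dihedral-∈ (inj₂ i) = closed _ b (^-∈ a∈ i) b∈

    b·a^ : ∀ j → b · a ^ j ≡ a ^ (j * M) · b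
    b·a^ zero    = trans (·-identityʳ b) (sym (·-identityˡ b))
    b·a^ (suc j) = begin
      b · (a · a ^ j)             ≡⟨ ·-assoc b∈ a∈ (^-∈ a∈ j) ⟨
      (b · a) · a ^ j             ≡⟨ cong (_· a ^ j) ba≡aᴹb ⟩
      (a ^ M · b) · a ^ j         ≡⟨ ·-assoc (^-∈ a∈ M) b∈ (^-∈ a∈ j) ⟩
      a ^ M · (b · a ^ j)         ≡⟨ cong (a ^ M ·_) (b·a^ j) ⟩
      a ^ M · (a ^ (j * M) · b)   ≡⟨ ·-assoc (^-∈ a∈ M) (^-∈ a∈ (j * M)) b∈ ⟨
      (a ^ M · a ^ (j * M)) · b   ≡⟨ cong (_· b) (^-+ a∈ M (j * M)) ⟨
      a ^ (M + j * M) · b         ∎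

    a^·a^b : ∀ i j → a ^ i · (a ^ j · b) ≡ a ^ (i + j) · b
    a^·a^b i j = trans (sym (·-assoc (^-∈ a∈ i) (^-∈ a∈ j) b∈)) (cong (_· b) (sym (^-+ a∈ i j)))

    dihedral-· : ∀ s t → dihedral s · dihedral t ≡ dihedral (s ⋆ t)
    dihedral-· (inj₁ i) (inj₁ j) = sym (^-+ a∈ i j)
    dihedral-· (inj₁ i) (inj₂ j) = a^·a^b i j
    dihedral-· (inj₂ i) (inj₁ j) = begin
      (a ^ i · b) · a ^ j          ≡⟨ ·-assoc (^-∈ a∈ i) b∈ (^-∈ a∈ j) ⟩
      a ^ i · (b · a ^ j)          ≡⟨ cong (a ^ i ·_) (b·a^ j) ⟩
      a ^ i · (a ^ (j * M) · b)    ≡⟨ a^·a^b i (j * M) ⟩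
      a ^ (i + j * M) · b          ∎
    dihedral-· (inj₂ i) (inj₂ j) = begin
      (a ^ i · b) · (a ^ j · b)        ≡⟨ ·-assoc (^-∈ a∈ i) b∈ (dihedral-∈ (inj₂ j)) ⟩
      a ^ i · (b · (a ^ j · b))        ≡⟨ cong (a ^ i ·_) (·-assoc b∈ (^-∈ a∈ j) b∈) ⟨
      a ^ i · ((b · a ^ j) · b)        ≡⟨ cong (λ w → a ^ i · (w · b)) (b·a^ j) ⟩
      a ^ i · ((a ^ (j * M) · b) · b)  ≡⟨ cong (a ^ i ·_) (·-assoc (^-∈ a∈ (j * M)) b∈ b∈) ⟩
      a ^ i · (a ^ (j * M) · (b · b))  ≡⟨ cong (λ w → a ^ i · (a ^ (j * M) · w)) b²≡𝟎 ⟩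
      a ^ i · (a ^ (j * M) · 𝟎)        ≡⟨ cong (a ^ i ·_) (·-identityʳ (a ^ (j * M))) ⟩
      a ^ i · a ^ (j * M)              ≡⟨ ^-+ a∈ i (j * M) ⟨
      a ^ (i + j * M)                  ∎

    a^[i+i*M]≡𝟎 : ∀ i → a ^ (i + i * M) ≡ 𝟎
    a^[i+i*M]≡𝟎 i = trans (cong (a ^_) (sym (*-suc i M))) (^-*≡𝟎 a∈ aᴺ≡𝟎 i)

    dihedral-inverse : ∀ s → dihedral s · dihedral (inverse s) ≡ 𝟎
    dihedral-inverse (inj₁ i) = trans (dihedral-· (inj₁ i) (inj₁ (i * M))) (a^[i+i*M]≡𝟎 i)
    dihedral-inverse (inj₂ i) = trans (dihedral-· (inj₂ i) (inj₂ i)) (a^[i+i*M]≡𝟎 i)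

    Gen⇒dihedral : ∀ {x} → Gen C π a b x → ∃ λ s → x ≡ dihedral s
    Gen⇒dihedral g𝟎 = inj₁ 0 , refl
    Gen⇒dihedral ga = inj₁ 1 , sym (·-identityʳ a)
    Gen⇒dihedral gb = inj₂ 0 , sym (·-identityˡ b)
    Gen⇒dihedral (gmul g h) with Gen⇒dihedral g | Gen⇒dihedral h
    ... | s , refl | t , refl = s ⋆ t , dihedral-· s t
    Gen⇒dihedral (ginv y∈ g yx≡𝟎) with Gen⇒dihedral g
    ... | s , refl = inverse s ,
      inverse-unique y∈ (dihedral-∈ s) (dihedral-∈ (inverse s)) yx≡𝟎 (dihedral-inverse s)

    enumeration : Fin (N + N) → Word m
    enumeration = dihedral ∘ Sum.map toℕ toℕ ∘ splitAt N

    a^-mod : ∀ i → a ^ i ≡ a ^ toℕ (i mod N)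
    a^-mod i = trans (^-% a∈ aᴺ≡𝟎 i) (cong (a ^_) (sym (toℕ-fromℕ< (m%n<n i N))))

    reduce : ℕ ⊎ ℕ → Fin N ⊎ Fin N
    reduce = Sum.map (_mod N) (_mod N)

    dihedral-reduce : ∀ s → dihedral s ≡ dihedral (Sum.map toℕ toℕ (reduce s))
    dihedral-reduce (inj₁ i) = a^-mod i
    dihedral-reduce (inj₂ i) = cong (_· b) (a^-mod i)

    Gen⇒enumerated : ∀ {x} → Gen C π a b x → ∃ λ k → x ≡ enumeration k
    Gen⇒enumerated g with Gen⇒dihedral g
    ... | s , refl = join N N (reduce s) ,
      trans (dihedral-reduce s) (cong (dihedral ∘ Sum.map toℕ toℕ) (sym (splitAt-join N N (reduce s))))

injective-covered⇒≤ : ∀ {A : Set} {p q} (f : Fin p → A) (e : Fin q → A) →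
                      Injective _≡_ _≡_ f → (∀ i → ∃ λ j → f i ≡ e j) → p ≤ q
injective-covered⇒≤ f e f-injective cover = injective⇒≤ {f = proj₁ ∘ cover} λ {i} {j} eq →
  f-injective (trans (proj₂ (cover i)) (trans (cong e eq) (sym (proj₂ (cover j)))))

Σℤ-cong : ∀ {m} {f g : Fin m → ℤ} → (∀ k → f k ≡ g k) → Σℤ f ≡ Σℤ g
Σℤ-cong {zero}  f≗g = refl
Σℤ-cong {suc m} f≗g = cong₂ ℤ._+_ (f≗g Fin.zero) (Σℤ-cong (f≗g ∘ Fin.suc))

Σℤ-ones : ∀ m → Σℤ {m} (λ _ → + 1) ≡ + m
Σℤ-ones zero    = refl
Σℤ-ones (suc m) = cong (ℤ._+_ (+ 1)) (Σℤ-ones m)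

Σℤ-minusOnes : ∀ m → Σℤ {suc m} (λ _ → -[1+ 0 ]) ≡ -[1+ m ]
Σℤ-minusOnes zero    = refl
Σℤ-minusOnes (suc m) = cong (ℤ._+_ -[1+ 0 ]) (Σℤ-minusOnes m)

±1 : ℤ → Set
±1 x = x ≡ + 1 ⊎ x ≡ -[1+ 0 ]

*-sameBit : ∀ {x y} → ±1 x → ±1 y → toBit x ≡ toBit y → x ℤ.* y ≡ + 1
*-sameBit (inj₁ refl) (inj₁ refl) _  = refl
*-sameBit (inj₁ refl) (inj₂ refl) ()
*-sameBit (inj₂ refl) (inj₁ refl) ()
*-sameBit (inj₂ refl) (inj₂ refl) _  = refl

*-oppositeBit : ∀ {x y} → ±1 x → ±1 y → toBit x ≡ not (toBit y) → x ℤ.* y ≡ -[1+ 0 ]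
*-oppositeBit (inj₁ refl) (inj₁ refl) ()
*-oppositeBit (inj₁ refl) (inj₂ refl) _  = refl
*-oppositeBit (inj₂ refl) (inj₁ refl) _  = refl
*-oppositeBit (inj₂ refl) (inj₂ refl) ()

map-not-injective : ∀ {m} {u v : Word m} → map not u ≡ map not v → u ≡ v
map-not-injective {u = u} {v} eq = word-ext λ k → not-injective (begin
  not (lookup u k)      ≡⟨ lookup-map k not u ⟨
  lookup (map not u) k  ≡⟨ cong (λ w → lookup w k) eq ⟩
  lookup (map not v) k  ≡⟨ lookup-map k not v ⟩
  not (lookup v k)      ∎)

codeword : ∀ {m} → (Fin m → Fin m → ℤ) → Fin m ⊎ Fin m → Word m
codeword H (inj₁ i) = binRow H i
codeword H (inj₂ i) = map not (binRow H i)

module HadamardRows {m} {H : Fin (suc m) → Fin (suc m) → ℤ} (isH : IsHadamard (suc m) H) where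
  open IsHadamard isH

  rowProduct : Fin (suc m) → Fin (suc m) → ℤ
  rowProduct i j = Σℤ (λ k → H i k ℤ.* H j k)

  rowProduct-nonneg : ∀ i j → ∃ λ c → rowProduct i j ≡ + c
  rowProduct-nonneg i j with i ≟ j
  ... | yes refl = suc m , diag i
  ... | no i≢j   = 0 , offdiag i j i≢j

  lookup-binRow : ∀ i k → lookup (binRow H i) k ≡ toBit (H i k)
  lookup-binRow i = lookup∘tabulate _

  rowProduct-sameBits : ∀ {i j} → binRow H i ≡ binRow H j → rowProduct i j ≡ + suc m
  rowProduct-sameBits {i} {j} eq = begin
    rowProduct i j          ≡⟨ Σℤ-cong (λ k → *-sameBit (entries i k) (entries j k) (sameBit k)) ⟩
    Σℤ {suc m} (λ _ → + 1)  ≡⟨ Σℤ-ones (suc m) ⟩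
    + suc m                 ∎
    where
    sameBit : ∀ k → toBit (H i k) ≡ toBit (H j k)
    sameBit k = begin
      toBit (H i k)          ≡⟨ lookup-binRow i k ⟨
      lookup (binRow H i) k  ≡⟨ cong (λ w → lookup w k) eq ⟩
      lookup (binRow H j) k  ≡⟨ lookup-binRow j k ⟩
      toBit (H j k)          ∎

  rowProduct-oppositeBits : ∀ {i j} → binRow H i ≡ map not (binRow H j) → rowProduct i j ≡ -[1+ m ]
  rowProduct-oppositeBits {i} {j} eq = begin
    rowProduct i j               ≡⟨ Σℤ-cong (λ k → *-oppositeBit (entries i k) (entries j k) (oppositeBit k)) ⟩
    Σℤ {suc m} (λ _ → -[1+ 0 ])  ≡⟨ Σℤ-minusOnes m ⟩
    -[1+ m ]                     ∎
    where
    oppositeBit : ∀ k → toBit (H i k) ≡ not (toBit (H j k))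
    oppositeBit k = begin
      toBit (H i k)                    ≡⟨ lookup-binRow i k ⟨
      lookup (binRow H i) k            ≡⟨ cong (λ w → lookup w k) eq ⟩
      lookup (map not (binRow H j)) k  ≡⟨ lookup-map k not (binRow H j) ⟩
      not (lookup (binRow H j) k)      ≡⟨ cong not (lookup-binRow j k) ⟩
      not (toBit (H j k))              ∎

  binRow-injective : ∀ {i j} → binRow H i ≡ binRow H j → i ≡ j
  binRow-injective {i} {j} eq with i ≟ j
  ... | yes i≡j = i≡j
  ... | no i≢j with trans (sym (offdiag i j i≢j)) (rowProduct-sameBits eq)
  ... | ()

  binRow≢complement : ∀ {i j} → binRow H i ≢ map not (binRow H j)
  binRow≢complement {i} {j} eq with rowProduct-nonneg i j
  ... | c , eq′ with trans (sym eq′) (rowProduct-oppositeBits eq)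
  ... | ()

  codeword-injective : Injective _≡_ _≡_ (codeword H)
  codeword-injective {inj₁ i} {inj₁ j} eq = cong inj₁ (binRow-injective eq)
  codeword-injective {inj₁ i} {inj₂ j} eq = ⊥-elim (binRow≢complement eq)
  codeword-injective {inj₂ i} {inj₁ j} eq = ⊥-elim (binRow≢complement (sym eq))
  codeword-injective {inj₂ i} {inj₂ j} eq = cong inj₂ (binRow-injective (map-not-injective eq))

hadamardCode-empty : ∀ {C : Code 0} → IsHadamardCode 0 C → ∀ x → ¬ C x
hadamardCode-empty (_ , _ , spans) x x∈ with proj₁ (spans x) x∈
... | () , _

hadamardCode-size : ∀ {m q} {C : Code m} → IsHadamardCode m C →
                    (e : Fin q → Word m) → (∀ x → C x → ∃ λ j → x ≡ e j) → m + m ≤ q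
hadamardCode-size {zero}  _                   _ _     = z≤n
hadamardCode-size {suc m} {C = C} (H , isH , spans) e cover =
  injective-covered⇒≤ (codeword H ∘ split) e injective (λ k → cover _ (codeword-∈ (split k)))
  where
  open HadamardRows isH
  split : Fin (suc m + suc m) → Fin (suc m) ⊎ Fin (suc m)
  split = splitAt (suc m)
  codeword-∈ : ∀ s → C (codeword H s)
  codeword-∈ (inj₁ i) = proj₂ (spans _) (i , inj₁ refl)
  codeword-∈ (inj₂ i) = proj₂ (spans _) (i , inj₂ refl)
  injective : Injective _≡_ _≡_ (codeword H ∘ split)
  injective {k} {l} eq = begin
    k                   ≡⟨ join-splitAt (suc m) (suc m) k ⟨
    join _ _ (split k)  ≡⟨ cong (join _ _) (codeword-injective {split k} {split l} eq) ⟩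
    join _ _ (split l)  ≡⟨ join-splitAt (suc m) (suc m) l ⟩
    l                   ∎

2n+2n<4n+4n : ∀ n → .{{_ : NonZero n}} → 2 * n + 2 * n < 4 * n + 4 * n
2n+2n<4n+4n n@(suc _) = subst (_< 4 * n + 4 * n) (*-distribʳ-+ n 2 2) (m<m+n (4 * n) (s≤s z≤n))

lemma7 : (n : ℕ) (C : Code (4 * n)) (π : Assignment (4 * n)) (a b : Word (4 * n)) →
         IsTypeQ n C π a b → (h : ℕ) → NonZero h → h ∣ n →
         actIter (π a) h (pow π a n) ≢ pow π a n
lemma7 zero C π a b Q _ _ _ _ =
  hadamardCode-empty (IsHFP.hadamard hfp) 𝟎 (IsPropelinear.zero∈ (IsHFP.propelinear hfp))
  where open IsTypeQ Q
lemma7 n@(suc _) C π a b Q h _ (divides q n≡q*h) πᵃʰaⁿ≡aⁿ =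
  <⇒≱ (2n+2n<4n+4n n) (hadamardCode-size hadamard enumeration λ x x∈ → Gen⇒enumerated (generates x x∈))
  where
  open IsTypeQ Q
  open IsHFP hfp
  open PropelinearGroup propelinear π𝟎-id

  -- a ^ suc M computes to a ^ (2 * n) because n is a successor.
  M : ℕ
  M = pred (2 * n)

  a²ⁿ≡𝟎 : a ^ (2 * n) ≡ 𝟎
  a²ⁿ≡𝟎 = ^-double≡𝟎 a∈ n
    (subst (λ k → actIter (π a) k (a ^ n) ≡ a ^ n) (sym n≡q*h) (actIter-* (π a) πᵃʰaⁿ≡aⁿ q))

  b²≡𝟎 : b · b ≡ 𝟎
  b²≡𝟎 = trans (sym rel2) a²ⁿ≡𝟎

  ba≡aᴹb : b · a ≡ a ^ M · b
  ba≡aᴹb with rel3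
  ... | _ , _ , b⁻¹∈ , a⁻¹∈ , b⁻¹b≡𝟎 , a⁻¹a≡𝟎 , b⁻¹ab≡a⁻¹ =
    involution-conjugate a∈ b∈ b⁻¹∈ a⁻¹∈ (^-∈ a∈ M) b²≡𝟎 a²ⁿ≡𝟎 b⁻¹b≡𝟎 a⁻¹a≡𝟎 b⁻¹ab≡a⁻¹

  open Dihedral a∈ b∈ M a²ⁿ≡𝟎 b²≡𝟎 ba≡aᴹb
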